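{- For all nonnegative integers $n,k,r$, $$F(n,k,r):=\sum_{i=0}^{k}(-1)^i\binom{n+1}{i}\binom{n+2k-2i-r}{n}=\binom{n+1}{2k-r}.$$
   Context: Binomial coefficients are taken with the convention that $\binom{m}{j}=0$ unless $0\le j\le m$ (in particular $\binom{m}{j}=0$ whenever $m<0$ or $j<0$). -}

module Defs where

open import Data.Nat as ℕ using (ℕ; zero; suc)
open import Data.Nat.Combinatorics using (_C_)
open import Data.Integer as ℤ using (ℤ; +_; -[1+_])

-- Binomial coefficient with integer arguments, following the convention
-- binom m j = 0 unless 0 ≤ j ≤ m (stdlib's  m C j  is already 0 for j > m).
binom : ℤ → ℤ → ℤ
binom (+ m)    (+ j)    = + (m C j)
binom (+ m)    -[1+ j ] = + 0
binom -[1+ m ] _        = + 0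

sign : ℕ → ℤ
sign zero    = + 1
sign (suc i) = ℤ.- sign i

sumTo : ℕ → (ℕ → ℤ) → ℤ
sumTo zero    f = f zero
sumTo (suc k) f = sumTo k f ℤ.+ f (suc k)

F : ℕ → ℕ → ℕ → ℤ
F n k r = sumTo k (λ i →
  sign i ℤ.* binom (+ (suc n)) (+ i)
         ℤ.* binom ((+ n ℤ.+ + (2 ℕ.* k)) ℤ.- (+ (2 ℕ.* i)) ℤ.- (+ r)) (+ n))

{-# OPTIONS --safe #-}
module Submission where

-- Let E be the shift s ↦ s + 1 acting on functions ℤ → ℤ. Then F n k r is the value at n + 2k
-- of (1 - E⁻²)^(n+1) applied to s ↦ C(s - r, n), the terms with i > k being zero anyway.
-- As 1 - E⁻² = (1 - E⁻¹)(1 + E⁻¹) and (1 - E⁻¹) C(·, n+1) = E⁻¹ C(·, n) by Pascal's rule,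
-- induction on n gives (1 - E⁻²)^(n+1) C(·, n) = (1 + E⁻¹)^(n+1) δ_n, whose value at t is C(n+1, t-n).

open import Defs
open import Data.Nat as ℕ using (ℕ; zero; suc; _*_; _<_; s≤s; z≤n)
import Data.Nat.Properties as ℕ
open import Data.Nat.Combinatorics using (k>n⇒nCk≡0; nCk+nC[k+1]≡[n+1]C[k+1])
open import Data.Integer as ℤ using (ℤ; +_; -[1+_]; _+_; _-_; -_) renaming (_*_ to _·_)
import Data.Integer.Properties as ℤ
open import Data.Integer.Tactic.RingSolver using (solve-∀)
open import Relation.Binary.PropositionalEquality using (_≡_; refl; sym; trans; cong; cong₂; module ≡-Reasoning)
open ≡-Reasoning

sumTo-cong : ∀ K {f g : ℕ → ℤ} → (∀ i → f i ≡ g i) → sumTo K f ≡ sumTo K g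
sumTo-cong zero    f≗g = f≗g zero
sumTo-cong (suc K) f≗g = cong₂ _+_ (sumTo-cong K f≗g) (f≗g (suc K))

sumTo-+ : ∀ K (f g : ℕ → ℤ) → sumTo K (λ i → f i + g i) ≡ sumTo K f + sumTo K g
sumTo-+ zero    f g = refl
sumTo-+ (suc K) f g = begin
  sumTo K (λ i → f i + g i) + (f (suc K) + g (suc K))
    ≡⟨ cong (_+ (f (suc K) + g (suc K))) (sumTo-+ K f g) ⟩
  (sumTo K f + sumTo K g) + (f (suc K) + g (suc K))
    ≡⟨ interchange (sumTo K f) (sumTo K g) (f (suc K)) (g (suc K)) ⟩
  (sumTo K f + f (suc K)) + (sumTo K g + g (suc K)) ∎
  where
  interchange : ∀ a b x y → (a + b) + (x + y) ≡ (a + x) + (b + y)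
  interchange = solve-∀

sumTo-neg : ∀ K (f : ℕ → ℤ) → sumTo K (λ i → - f i) ≡ - sumTo K f
sumTo-neg zero    f = refl
sumTo-neg (suc K) f = begin
  sumTo K (λ i → - f i) + - f (suc K) ≡⟨ cong (_+ - f (suc K)) (sumTo-neg K f) ⟩
  - sumTo K f + - f (suc K)           ≡⟨ sym (ℤ.neg-distrib-+ (sumTo K f) (f (suc K))) ⟩
  - (sumTo K f + f (suc K))           ∎

sumTo-suc : ∀ K (f : ℕ → ℤ) → sumTo (suc K) f ≡ f zero + sumTo K (λ i → f (suc i))
sumTo-suc zero    f = refl
sumTo-suc (suc K) f = begin
  sumTo (suc K) f + f (suc (suc K))
    ≡⟨ cong (_+ f (suc (suc K))) (sumTo-suc K f) ⟩
  f zero + sumTo K (λ i → f (suc i)) + f (suc (suc K))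
    ≡⟨ ℤ.+-assoc (f zero) _ _ ⟩
  f zero + (sumTo K (λ i → f (suc i)) + f (suc (suc K))) ∎

sumTo-extend : ∀ K d (f : ℕ → ℤ) → (∀ j → f (suc (K ℕ.+ j)) ≡ + 0) →
               sumTo (K ℕ.+ d) f ≡ sumTo K f
sumTo-extend K zero    f tail≡0 = cong (λ m → sumTo m f) (ℕ.+-identityʳ K)
sumTo-extend K (suc d) f tail≡0 = begin
  sumTo (K ℕ.+ suc d) f                 ≡⟨ cong (λ m → sumTo m f) (ℕ.+-suc K d) ⟩
  sumTo (K ℕ.+ d) f + f (suc (K ℕ.+ d)) ≡⟨ cong₂ _+_ (sumTo-extend K d f tail≡0) (tail≡0 d) ⟩
  sumTo K f + + 0                       ≡⟨ ℤ.+-identityʳ (sumTo K f) ⟩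
  sumTo K f                             ∎

col : ℕ → ℤ → ℤ
col n s = binom s (+ n)

binom-pascal : ∀ m j → binom (+ suc m) (ℤ.suc j) ≡ binom (+ m) j + binom (+ m) (ℤ.suc j)
binom-pascal m (+ k)          = cong +_ (sym (nCk+nC[k+1]≡[n+1]C[k+1] m k))
binom-pascal m -[1+ zero ]    = refl
binom-pascal m -[1+ suc k ]   = refl

col-pascal : ∀ n s → col (suc n) (ℤ.suc s) ≡ col n s + col (suc n) s
col-pascal n (+ m)          = cong +_ (sym (nCk+nC[k+1]≡[n+1]C[k+1] m n))
col-pascal n -[1+ zero ]    = refl
col-pascal n -[1+ suc m ]   = refl

col-vanish : ∀ {n x} m → x + + suc m ≡ + n → col n x ≡ + 0
col-vanish {n} {+ a}    m x+m+1≡n =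
  cong +_ (k>n⇒nCk≡0 (ℕ.≤-trans (ℕ.m<m+n a (s≤s z≤n)) (ℕ.≤-reflexive (ℤ.+-injective x+m+1≡n))))
col-vanish {x = -[1+ a ]} m _ = refl

-- altSum K m g t = ((1 - E⁻²)^m g)(t) as soon as K ≥ m.
altTerm : ℕ → (ℤ → ℤ) → ℤ → ℕ → ℤ
altTerm m g t i = sign i · binom (+ m) (+ i) · g (t - + (2 * i))

altSum : ℕ → ℕ → (ℤ → ℤ) → ℤ → ℤ
altSum K m g t = sumTo K (altTerm m g t)

altTerm-vanish : ∀ {m i} (g : ℤ → ℤ) t → m < i → altTerm m g t i ≡ + 0
altTerm-vanish {m} {i} g t m<i = begin
  sign i · binom (+ m) (+ i) · g (t - + (2 * i)) ≡⟨ cong (λ c → sign i · + c · g (t - + (2 * i))) (k>n⇒nCk≡0 m<i) ⟩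
  sign i · + 0 · g (t - + (2 * i))              ≡⟨ cong (_· g (t - + (2 * i))) (ℤ.*-zeroʳ (sign i)) ⟩
  + 0 · g (t - + (2 * i))                       ≡⟨ ℤ.*-zeroˡ (g (t - + (2 * i))) ⟩
  + 0                                           ∎

altSum-cong : ∀ K m {g h : ℤ → ℤ} → (∀ s → g s ≡ h s) → ∀ t → altSum K m g t ≡ altSum K m h t
altSum-cong K m g≗h t = sumTo-cong K λ i → cong (sign i · binom (+ m) (+ i) ·_) (g≗h (t - + (2 * i)))

altSum-+ : ∀ K m (g h : ℤ → ℤ) t →
           altSum K m (λ s → g s + h s) t ≡ altSum K m g t + altSum K m h t
altSum-+ K m g h t = trans (sumTo-cong K distrib) (sumTo-+ K (altTerm m g t) (altTerm m h t))
  where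
  distribˡ : ∀ c x y → c · (x + y) ≡ c · x + c · y
  distribˡ = solve-∀
  distrib : ∀ i → altTerm m (λ s → g s + h s) t i ≡ altTerm m g t i + altTerm m h t i
  distrib i = distribˡ (sign i · binom (+ m) (+ i)) (g (t - + (2 * i))) (h (t - + (2 * i)))

altSum-translate : ∀ K m (g : ℤ → ℤ) t a → altSum K m (λ s → g (s + a)) t ≡ altSum K m g (t + a)
altSum-translate K m g t a = sumTo-cong K λ i →
  cong (λ x → sign i · binom (+ m) (+ i) · g x) (reorder t a (+ (2 * i)))
  where
  reorder : ∀ t a b → (t - b) + a ≡ (t + a) - b
  reorder = solve-∀

altSum-extend : ∀ K d m (g : ℤ → ℤ) t → (∀ j → g (t - + (2 * suc (K ℕ.+ j))) ≡ + 0) →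
                altSum (K ℕ.+ d) m g t ≡ altSum K m g t
altSum-extend K d m g t tail≡0 = sumTo-extend K d (altTerm m g t) λ j →
  let i = suc (K ℕ.+ j) in
  trans (cong (sign i · binom (+ m) (+ i) ·_) (tail≡0 j)) (ℤ.*-zeroʳ (sign i · binom (+ m) (+ i)))

altSum-zero : ∀ K (g : ℤ → ℤ) t → altSum K 0 g t ≡ g t
altSum-zero K g t = begin
  sumTo (0 ℕ.+ K) (altTerm 0 g t) ≡⟨ sumTo-extend 0 K (altTerm 0 g t) (λ j → altTerm-vanish {i = suc j} g t (s≤s z≤n)) ⟩
  + 1 · g (t + + 0)               ≡⟨ ℤ.*-identityˡ (g (t + + 0)) ⟩
  g (t + + 0)                     ≡⟨ cong g (ℤ.+-identityʳ t) ⟩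
  g t                             ∎

-- m < K makes the top term C(m,K) of the index-shifted sum vanish.
altSum-pascal : ∀ K m (g : ℤ → ℤ) t → m < K →
                altSum K (suc m) g t ≡ altSum K m g t - altSum K m g (t - + 2)
altSum-pascal (suc K) m g t m<K = begin
  sumTo (suc K) (altTerm (suc m) g t)
    ≡⟨ sumTo-suc K (altTerm (suc m) g t) ⟩
  a zero + sumTo K (λ i → altTerm (suc m) g t (suc i))
    ≡⟨ cong (_+_ (a zero)) (sumTo-cong K split) ⟩
  a zero + sumTo K (λ i → a (suc i) + - b i)
    ≡⟨ cong (_+_ (a zero)) (trans (sumTo-+ K _ _) (cong (_+_ (sumTo K (λ i → a (suc i)))) (sumTo-neg K b))) ⟩
  a zero + (sumTo K (λ i → a (suc i)) + - sumTo K b)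
    ≡⟨ regroup (a zero) (sumTo K (λ i → a (suc i))) (sumTo K b) ⟩
  (a zero + sumTo K (λ i → a (suc i))) - (sumTo K b + + 0)
    ≡⟨ cong₂ _-_ (sym (sumTo-suc K a)) (cong (_+_ (sumTo K b)) (sym top≡0)) ⟩
  sumTo (suc K) a - sumTo (suc K) b ∎
  where
  a b : ℕ → ℤ
  a = altTerm m g t
  b = altTerm m g (t - + 2)
  regroup : ∀ x y z → x + (y + - z) ≡ (x + y) - (z + + 0)
  regroup = solve-∀
  expand : ∀ s x y c → (- s) · (x + y) · c ≡ (- s) · y · c + - (s · x · c)
  expand = solve-∀
  split : ∀ i → altTerm (suc m) g t (suc i) ≡ a (suc i) + - b i
  split i = begin
    (- sign i) · binom (+ suc m) (+ suc i) · g (t - + (2 * suc i))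
      ≡⟨ cong (λ c → (- sign i) · c · g (t - + (2 * suc i))) (binom-pascal m (+ i)) ⟩
    (- sign i) · (binom (+ m) (+ i) + binom (+ m) (+ suc i)) · g (t - + (2 * suc i))
      ≡⟨ expand (sign i) (binom (+ m) (+ i)) (binom (+ m) (+ suc i)) (g (t - + (2 * suc i))) ⟩
    a (suc i) + - (sign i · binom (+ m) (+ i) · g (t - + (2 * suc i)))
      ≡⟨ cong (λ x → a (suc i) + - (sign i · binom (+ m) (+ i) · g x)) (two-steps i) ⟩
    a (suc i) + - b i ∎
    where
    sub-+ : ∀ t x y → t - (x + y) ≡ (t - x) - y
    sub-+ = solve-∀
    two-steps : ∀ i → t - + (2 * suc i) ≡ (t - + 2) - + (2 * i)
    two-steps i = trans (cong (λ n → t - + n) (ℕ.*-suc 2 i)) (sub-+ t (+ 2) (+ (2 * i)))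
  top≡0 : b (suc K) ≡ + 0
  top≡0 = altTerm-vanish {i = suc K} g (t - + 2) m<K

altSum-col : ∀ n K → n < K → ∀ t → altSum K (suc n) (col n) t ≡ binom (+ suc n) (t - + n)
altSum-col zero (suc K) _ t = begin
  altSum (suc K) 1 (col 0) t                                ≡⟨ altSum-pascal (suc K) 0 (col 0) t (s≤s z≤n) ⟩
  altSum (suc K) 0 (col 0) t - altSum (suc K) 0 (col 0) u   ≡⟨ cong₂ _-_ (altSum-zero (suc K) (col 0) t) (altSum-zero (suc K) (col 0) u) ⟩
  col 0 t - col 0 u                                         ≡⟨ jump t ⟩
  binom (+ 1) (t - + 0)                                     ∎
  where
  u = t - + 2
  jump : ∀ t → col 0 t - col 0 (t - + 2) ≡ binom (+ 1) (t - + 0)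
  jump (+ zero)          = refl
  jump (+ suc zero)      = refl
  jump (+ suc (suc m))   = refl
  jump -[1+ m ]          = refl
altSum-col (suc n) K n+1<K t = begin
  altSum K (suc (suc n)) (col (suc n)) t  ≡⟨ altSum-pascal K (suc n) (col (suc n)) t n+1<K ⟩
  A t - A u                               ≡⟨ cong (λ x → A x - A u) (t≡u+1+1 t) ⟩
  A ((u + + 1) + + 1) - A u               ≡⟨ cong (_- A u) (trans (A-step (u + + 1)) (cong (_+_ (S (u + + 1))) (A-step u))) ⟩
  (S (u + + 1) + (S u + A u)) - A u       ≡⟨ cancel (S (u + + 1)) (S u) (A u) ⟩
  S u + S (u + + 1)                       ≡⟨ cong₂ _+_ (altSum-col n K n<K u) (altSum-col n K n<K (u + + 1)) ⟩
  binom (+ suc n) (u - + n) + binom (+ suc n) ((u + + 1) - + n)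
    ≡⟨ cong (λ x → binom (+ suc n) (u - + n) + binom (+ suc n) x) (shift u (+ n)) ⟩
  binom (+ suc n) (u - + n) + binom (+ suc n) (ℤ.suc (u - + n))
    ≡⟨ sym (binom-pascal (suc n) (u - + n)) ⟩
  binom (+ suc (suc n)) (ℤ.suc (u - + n)) ≡⟨ cong (binom (+ suc (suc n))) (unshift t (+ n)) ⟩
  binom (+ suc (suc n)) (t - + suc n)     ∎
  where
  n<K = ℕ.<-trans (ℕ.n<1+n n) n+1<K
  u = t - + 2
  S A : ℤ → ℤ
  S = altSum K (suc n) (col n)
  A = altSum K (suc n) (col (suc n))
  A-step : ∀ s → A (s + + 1) ≡ S s + A s
  A-step s = begin
    A (s + + 1)                                            ≡⟨ sym (altSum-translate K (suc n) (col (suc n)) s (+ 1)) ⟩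
    altSum K (suc n) (λ x → col (suc n) (x + + 1)) s       ≡⟨ altSum-cong K (suc n) pascal s ⟩
    altSum K (suc n) (λ x → col n x + col (suc n) x) s     ≡⟨ altSum-+ K (suc n) (col n) (col (suc n)) s ⟩
    S s + A s                                              ∎
    where
    pascal : ∀ x → col (suc n) (x + + 1) ≡ col n x + col (suc n) x
    pascal x = trans (cong (col (suc n)) (ℤ.+-comm x (+ 1))) (col-pascal n x)
  t≡u+1+1 : ∀ t → t ≡ ((t - + 2) + + 1) + + 1
  t≡u+1+1 = solve-∀
  cancel : ∀ a b x → (a + (b + x)) - x ≡ b + a
  cancel = solve-∀
  shift : ∀ u m → (u + + 1) - m ≡ + 1 + (u - m)
  shift = solve-∀
  unshift : ∀ t m → + 1 + ((t - + 2) - m) ≡ t - (+ 1 + m)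
  unshift = solve-∀

mainTheorem1 : (n k r : ℕ) → F n k r ≡ binom (+ (suc n)) (+ (2 * k) - + r)
mainTheorem1 n k r = begin
  F n k r                                    ≡⟨ altSum-translate k (suc n) (col n) (+ n + + (2 * k)) (- + r) ⟩
  altSum k (suc n) (col n) t                 ≡⟨ sym (altSum-extend k (suc n) (suc n) (col n) t tail≡0) ⟩
  altSum (k ℕ.+ suc n) (suc n) (col n) t     ≡⟨ altSum-col n (k ℕ.+ suc n) (ℕ.m≤n+m (suc n) k) t ⟩
  binom (+ suc n) (t - + n)                  ≡⟨ cong (binom (+ suc n)) (cancel-n (+ n) (+ (2 * k)) (+ r)) ⟩
  binom (+ suc n) (+ (2 * k) - + r)          ∎
  where
  t = + n + + (2 * k) - + r
  cancel-n : ∀ n y r → ((n + y) - r) - n ≡ y - r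
  cancel-n = solve-∀
  below-n : ∀ n a b r → ((n + a) - r) - (a + b) + (b + r) ≡ n
  below-n = solve-∀
  tail≡0 : ∀ j → col n (t - + (2 * suc (k ℕ.+ j))) ≡ + 0
  tail≡0 j = col-vanish _ (begin
    t - + (2 * suc (k ℕ.+ j)) + + (2 * suc j ℕ.+ r)
      ≡⟨ cong (λ m → t - + m + + (2 * suc j ℕ.+ r)) double ⟩
    t - (+ (2 * k) + + (2 * suc j)) + (+ (2 * suc j) + + r)
      ≡⟨ below-n (+ n) (+ (2 * k)) (+ (2 * suc j)) (+ r) ⟩
    + n ∎)
    where
    double : 2 * suc (k ℕ.+ j) ≡ 2 * k ℕ.+ 2 * suc j
    double = trans (cong (2 *_) (sym (ℕ.+-suc k j))) (ℕ.*-distribˡ-+ 2 k (suc j))
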